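{- Let $\mathcal{A}$ be a sub-family of $2^{[n]}$, let $i,j\in[n]$ with $i\neq j$, and let $\mathcal{B}=\Delta_{i,j}(\mathcal{A})$. Then: (i) if $A\in\mathcal{A}^*$ then $\delta_{i,j}(A)\in\mathcal{B}^*$; (ii) if $A\in\mathcal{A}^*\setminus\mathcal{B}^*$ then $\delta_{i,j}(A)\notin\mathcal{A}^*$; (iii) if $B\in\mathcal{B}^*$ then $\delta_{i,j}(B)\in\mathcal{B}^*$; (iv) $|\mathcal{A}^*|\leq|\mathcal{B}^*|$.
   Context: $[n]=\{1,\dots,n\}$. For $x,y\in[n]$, $\delta_{x,y}:2^{[n]}\to2^{[n]}$ is defined by $\delta_{x,y}(A)=(A\setminus\{y\})\cup\{x\}$ if $y\in A$ and $x\notin A$, and $\delta_{x,y}(A)=A$ otherwise. The compression $\Delta_{x,y}$ maps a family $\mathcal{A}\subseteq2^{[n]}$ to $\Delta_{x,y}(\mathcal{A})=\{\delta_{x,y}(A):A\in\mathcal{A},\ \delta_{x,y}(A)\notin\mathcal{A}\}\cup\{A\in\mathcal{A}:\delta_{x,y}(A)\in\mathcal{A}\}$. For any family $\mathcal{F}$, $\mathcal{F}^*=\{A\in\mathcal{F}: A\cap B\neq\emptyset\text{ for every }B\in\mathcal{F}\}$. -}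

module Defs where

open import Data.Bool using (Bool; true; false; not; _∧_; _∨_; if_then_else_)
open import Data.Nat using (ℕ; zero; suc)
open import Data.Fin using (Fin)
open import Data.Fin.Subset using (Subset; inside; outside; _∩_; ⊥)
open import Data.Vec.Properties using (≡-dec)
import Data.Bool as B
open import Relation.Binary.PropositionalEquality using (_≡_)
open import Data.Vec using (Vec; []; _∷_; lookup; _[_]≔_)
open import Data.List using (List; []; _∷_; _++_; map; filter; length)
open import Data.Bool.ListAction using (any; all)
open import Relation.Nullary.Decidable using (⌊_⌋)

Family : ℕ → Set
Family n = Subset n → Bool

_∈F_ : ∀ {n} → Subset n → Family n → Set
A ∈F 𝒜 = 𝒜 A ≡ true

allSubsets : (n : ℕ) → List (Subset n)
allSubsets zero    = [] ∷ []
allSubsets (suc n) = map (inside ∷_) (allSubsets n) ++ map (outside ∷_) (allSubsets n)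

card : ∀ {n} → Family n → ℕ
card {n} 𝒜 = length (filter (λ A → 𝒜 A B.≟ true) (allSubsets n))

_==_ : ∀ {n} → Subset n → Subset n → Bool
A == C = ⌊ ≡-dec B._≟_ A C ⌋

δ : ∀ {n} → Fin n → Fin n → Subset n → Subset n
δ x y A = if lookup A y ∧ not (lookup A x)
          then ((A [ y ]≔ outside) [ x ]≔ inside)
          else A

-- Δ_{x,y}(𝒜) = {δ(A) : A ∈ 𝒜, δ(A) ∉ 𝒜} ∪ {A ∈ 𝒜 : δ(A) ∈ 𝒜}
Δ : ∀ {n} → Fin n → Fin n → Family n → Family n
Δ {n} x y 𝒜 B =
  any (λ A → 𝒜 A ∧ not (𝒜 (δ x y A)) ∧ (δ x y A == B)) (allSubsets n)
  ∨ (𝒜 B ∧ 𝒜 (δ x y B))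

meets : ∀ {n} → Subset n → Subset n → Bool
meets A B = not ((A ∩ B) == ⊥)

_* : ∀ {n} → Family n → Family n
_* {n} 𝓕 A = 𝓕 A ∧ all (λ B → not (𝓕 B) ∨ meets A B) (allSubsets n)

-- Write δ for δ_{i,j}, which moves j to i, and ℬ for Δ_{i,j}(𝒜).
-- (i) For A ∈ 𝒜*, δA lies in ℬ, and meets every member of ℬ: a set δA' with A' ∈ 𝒜 because
-- compressing two intersecting sets keeps them intersecting (a common j becomes a common i),
-- and a set C ∈ 𝒜 with δC ∈ 𝒜 because A meets both C and δC.
-- (iii) ℬ is closed under δ since δ is idempotent, and the same argument runs inside ℬ.
-- (ii) If A is moved and both A and δA lie in 𝒜*, then A stays in ℬ and meets each new
-- member δA' of ℬ: a common point of δA and A' is neither i (A' was moved, so i ∉ A')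
-- nor j (else i ∈ A), hence lies in A and in δA'.
-- (iv) A ↦ (A if A ∈ ℬ*, δA otherwise) maps 𝒜* into ℬ* by (i), and is injective by (ii)
-- and because δ is injective on the sets it moves.

module Submission where

open import Defs
open import Data.Bool using (Bool; true; false; not; _∧_; _∨_; if_then_else_; T)
open import Data.Bool.Properties using (T-≡; T-∧; T-∨; T-not-≡; ¬-not; not-¬)
import Data.Bool as Bool
open import Data.Empty using (⊥; ⊥-elim)
open import Data.Fin using (Fin) renaming (_≟_ to _≟ᶠ_)
open import Data.Fin.Subset using (Subset; inside; outside; _∩_)
  renaming (⊥ to ∅)
open import Data.Fin.Subset.Properties using (nonempty?; Empty-unique; x∈p∩q⁺; x∈p∩q⁻)
open import Data.List using (List; []; _∷_; length; map; filter)
open import Data.List.Properties using (length-map; length-removeAt′)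
open import Data.List.Membership.Propositional using (_∈_; _─_; lose)
open import Data.List.Membership.Propositional.Properties
  using (∈-filter⁺; ∈-filter⁻; ∈-map⁺; ∈-map⁻; ∈-++⁺ˡ; ∈-++⁺ʳ)
open import Data.List.Relation.Binary.Subset.Propositional using (_⊆_)
open import Data.List.Relation.Unary.Any using (here; there; index; satisfied)
open import Data.List.Relation.Unary.Any.Properties using (any⁺; any⁻)
import Data.List.Relation.Unary.All as All
open import Data.List.Relation.Unary.All.Properties using (all⁺; all⁻)
import Data.List.Relation.Unary.All.Properties as All
open import Data.List.Relation.Unary.AllPairs using ([]; _∷_)
open import Data.List.Relation.Unary.Unique.Propositional using (Unique)
import Data.List.Relation.Unary.Unique.Propositional.Properties as Unique
open import Data.Nat using (ℕ; zero; suc; _≤_; z≤n; s≤s)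
open import Data.Nat.Properties using (module ≤-Reasoning)
open import Data.Product using (_×_; _,_; proj₁; proj₂; ∃-syntax)
open import Data.Sum using (_⊎_; inj₁; inj₂)
open import Data.Vec using ([]; _∷_; lookup; tabulate; _[_]≔_)
open import Data.Vec.Properties using (lookup∘update; lookup∘update′; ≡-dec;
  ∷-injectiveʳ; tabulate∘lookup; tabulate-cong; []=⇒lookup; lookup⇒[]=; lookup-replicate)
open import Function using (_∘_)
open import Function.Bundles using (Equivalence)
open import Relation.Binary.PropositionalEquality
open import Relation.Nullary using (¬_; yes; no)
open import Relation.Nullary.Decidable using (toWitness; fromWitness)
open Equivalence using (to; from)

module _ {X : Set} where

  ∈-─⁺ : ∀ {x y : X} {ys} (y∈ys : y ∈ ys) → x ∈ ys → x ≢ y → x ∈ ys ─ y∈ys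
  ∈-─⁺ (here refl) (here refl)  x≢y = ⊥-elim (x≢y refl)
  ∈-─⁺ (here refl) (there x∈ys) _   = x∈ys
  ∈-─⁺ (there _)   (here refl)  _   = here refl
  ∈-─⁺ (there y∈ys) (there x∈ys) x≢y = there (∈-─⁺ y∈ys x∈ys x≢y)

  Unique-⊆⇒length-≤ : ∀ {xs ys : List X} → Unique xs → xs ⊆ ys → length xs ≤ length ys
  Unique-⊆⇒length-≤ {[]}     _              _     = z≤n
  Unique-⊆⇒length-≤ {x ∷ xs} {ys} (x∉xs ∷ uxs) xs⊆ys = begin
    suc (length xs)             ≤⟨ s≤s (Unique-⊆⇒length-≤ uxs xs⊆ys─x) ⟩
    suc (length (ys ─ x∈ys))    ≡⟨ length-removeAt′ ys (index x∈ys) ⟨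
    length ys                   ∎
    where
    open ≤-Reasoning
    x∈ys : x ∈ ys
    x∈ys = xs⊆ys (here refl)
    xs⊆ys─x : xs ⊆ ys ─ x∈ys
    xs⊆ys─x z∈xs = ∈-─⁺ x∈ys (xs⊆ys (there z∈xs)) (λ z≡x → All.lookup x∉xs z∈xs (sym z≡x))

  Unique-map⁺-injectiveOn : ∀ {Y : Set} {f : X → Y} {xs} →
    (∀ {x y} → x ∈ xs → y ∈ xs → f x ≡ f y → x ≡ y) → Unique xs → Unique (map f xs)
  Unique-map⁺-injectiveOn {xs = []}    _   []           = []
  Unique-map⁺-injectiveOn {xs = _ ∷ _} inj (x∉xs ∷ uxs) =
    All.map⁺ (All.tabulate λ y∈xs fx≡fy →
                All.lookup x∉xs y∈xs (inj (here refl) (there y∈xs) fx≡fy))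
    ∷ Unique-map⁺-injectiveOn (λ x∈ y∈ → inj (there x∈) (there y∈)) uxs

∈-allSubsets : ∀ {n} (A : Subset n) → A ∈ allSubsets n
∈-allSubsets {zero}  []          = here refl
∈-allSubsets {suc n} (true ∷ A)  = ∈-++⁺ˡ (∈-map⁺ (inside ∷_) (∈-allSubsets A))
∈-allSubsets {suc n} (false ∷ A) =
  ∈-++⁺ʳ (map (inside ∷_) (allSubsets n)) (∈-map⁺ (outside ∷_) (∈-allSubsets A))

allSubsets-Unique : ∀ n → Unique (allSubsets n)
allSubsets-Unique zero    = All.[] ∷ []
allSubsets-Unique (suc n) =
  Unique.++⁺ (Unique.map⁺ ∷-injectiveʳ (allSubsets-Unique n))
             (Unique.map⁺ ∷-injectiveʳ (allSubsets-Unique n))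
             disjoint
  where
  disjoint : ∀ {A} → A ∈ map (inside ∷_) (allSubsets n) × A ∈ map (outside ∷_) (allSubsets n) → ⊥
  disjoint (p , q) with ∈-map⁻ (inside ∷_) p | ∈-map⁻ (outside ∷_) q
  ... | _ , _ , refl | _ , _ , ()

members : ∀ {n} → Family n → List (Subset n)
members {n} 𝒜 = filter (λ A → 𝒜 A Bool.≟ true) (allSubsets n)

card-≤-injection : ∀ {n} (𝒜 ℬ : Family n) (f : Subset n → Subset n) →
  (∀ {A} → A ∈F 𝒜 → f A ∈F ℬ) →
  (∀ {A C} → A ∈F 𝒜 → C ∈F 𝒜 → f A ≡ f C → A ≡ C) →
  card 𝒜 ≤ card ℬ
card-≤-injection {n} 𝒜 ℬ f maps inj = begin
  length (members 𝒜)         ≡⟨ length-map f (members 𝒜) ⟨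
  length (map f (members 𝒜)) ≤⟨ Unique-⊆⇒length-≤ unique image⊆ ⟩
  length (members ℬ)         ∎
  where
  open ≤-Reasoning
  ∈𝒜 : ∀ {A} → A ∈ members 𝒜 → A ∈F 𝒜
  ∈𝒜 A∈ = proj₂ (∈-filter⁻ (λ A → 𝒜 A Bool.≟ true) {xs = allSubsets n} A∈)
  unique : Unique (map f (members 𝒜))
  unique = Unique-map⁺-injectiveOn (λ A∈ C∈ → inj (∈𝒜 A∈) (∈𝒜 C∈))
                                   (Unique.filter⁺ (λ A → 𝒜 A Bool.≟ true) (allSubsets-Unique n))
  image⊆ : map f (members 𝒜) ⊆ members ℬ
  image⊆ fA∈ with ∈-map⁻ f fA∈
  ... | A , A∈ , refl = ∈-filter⁺ (λ C → ℬ C Bool.≟ true) (∈-allSubsets (f A)) (maps (∈𝒜 A∈))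

cong-lookup : ∀ {n} {S S' : Subset n} → S ≡ S' → ∀ k → lookup S k ≡ lookup S' k
cong-lookup S≡S' k = cong (λ S → lookup S k) S≡S'

record Meets {n} (A C : Subset n) : Set where
  constructor common
  field
    point : Fin n
    point∈ˡ : lookup A point ≡ true
    point∈ʳ : lookup C point ≡ true

meets⇒Meets : ∀ {n} {A C : Subset n} → meets A C ≡ true → Meets A C
meets⇒Meets {A = A} {C} A⋈C with ≡-dec Bool._≟_ (A ∩ C) ∅ | nonempty? (A ∩ C)
... | no _       | yes (k , k∈A∩C) =
  let k∈A , k∈C = x∈p∩q⁻ A C k∈A∩C in common k ([]=⇒lookup k∈A) ([]=⇒lookup k∈C)
... | no A∩C≢∅  | no A∩C-empty = ⊥-elim (A∩C≢∅ (Empty-unique A∩C-empty))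
meets⇒Meets () | yes _ | _

Meets⇒meets : ∀ {n} {A C : Subset n} → Meets A C → meets A C ≡ true
Meets⇒meets {A = A} {C} (common k k∈A k∈C) with ≡-dec Bool._≟_ (A ∩ C) ∅
... | no _        = refl
... | yes A∩C≡∅ with () ←
  trans (sym ([]=⇒lookup (x∈p∩q⁺ (lookup⇒[]= k A k∈A , lookup⇒[]= k C k∈C))))
        (trans (cong-lookup A∩C≡∅ k) (lookup-replicate k outside))

∈*⁻ : ∀ {n} (𝓕 : Family n) {A} → A ∈F (𝓕 *) → A ∈F 𝓕 × (∀ {C} → C ∈F 𝓕 → Meets A C)
∈*⁻ {n} 𝓕 {A} A∈𝓕* with 𝓕 A
... | true = refl , λ {C} C∈𝓕 → meets⇒Meets (to T-≡ (subst (λ b → T (not b ∨ meets A C)) C∈𝓕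
                      (All.lookup (all⁺ _ (allSubsets n) (from T-≡ A∈𝓕*)) (∈-allSubsets C))))

∈*⁺ : ∀ {n} (𝓕 : Family n) {A} → A ∈F 𝓕 → (∀ {C} → C ∈F 𝓕 → Meets A C) → A ∈F (𝓕 *)
∈*⁺ {n} 𝓕 {A} A∈𝓕 meetsAll rewrite A∈𝓕 =
  to T-≡ (all⁻ _ {allSubsets n} (All.tabulate λ {C} _ → from T-≡ (meetsOrOutside C)))
  where
  meetsOrOutside : ∀ C → (not (𝓕 C) ∨ meets A C) ≡ true
  meetsOrOutside C with 𝓕 C in C∈𝓕
  ... | false = refl
  ... | true  = Meets⇒meets (meetsAll C∈𝓕)

module Δ-membership {n} (x y : Fin n) (𝒜 : Family n) where

  ∈Δ⁺-moved : ∀ {A} → A ∈F 𝒜 → 𝒜 (δ x y A) ≡ false → δ x y A ∈F Δ x y 𝒜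
  ∈Δ⁺-moved {A} A∈𝒜 δA∉𝒜 = to T-≡ (from T-∨ (inj₁ (any⁺ _ (lose (∈-allSubsets A)
    (from T-∧ (from T-≡ A∈𝒜 , from T-∧ (from T-not-≡ δA∉𝒜 , fromWitness refl)))))))

  ∈Δ⁺-kept : ∀ {B} → B ∈F 𝒜 → δ x y B ∈F 𝒜 → B ∈F Δ x y 𝒜
  ∈Δ⁺-kept B∈𝒜 δB∈𝒜 = to T-≡ (from T-∨ (inj₂ (from T-∧ (from T-≡ B∈𝒜 , from T-≡ δB∈𝒜))))

  ∈Δ⁻ : ∀ {B} → B ∈F Δ x y 𝒜 →
    (∃[ A ] A ∈F 𝒜 × 𝒜 (δ x y A) ≡ false × δ x y A ≡ B) ⊎ (B ∈F 𝒜 × δ x y B ∈F 𝒜)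
  ∈Δ⁻ B∈Δ with to T-∨ (from T-≡ B∈Δ)
  ... | inj₂ kept = let B∈𝒜 , δB∈𝒜 = to T-∧ kept in inj₂ (to T-≡ B∈𝒜 , to T-≡ δB∈𝒜)
  ... | inj₁ moved with satisfied (any⁻ _ (allSubsets n) moved)
  ...   | A , witness =
    let A∈𝒜 , rest = to T-∧ witness
        δA∉𝒜 , δA≡B = to T-∧ rest
    in inj₁ (A , to T-≡ A∈𝒜 , to T-not-≡ δA∉𝒜 , toWitness δA≡B)

module Shift {n} {i j : Fin n} (i≢j : i ≢ j) where

  shift : Subset n → Subset n
  shift A = (A [ j ]≔ outside) [ i ]≔ inside

  i∈shift : ∀ A → lookup (shift A) i ≡ true
  i∈shift A = lookup∘update i (A [ j ]≔ outside) inside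

  j∉shift : ∀ A → lookup (shift A) j ≡ false
  j∉shift A =
    trans (lookup∘update′ (i≢j ∘ sym) (A [ j ]≔ outside) inside) (lookup∘update j A outside)

  lookup-shift : ∀ A {k} → k ≢ i → k ≢ j → lookup (shift A) k ≡ lookup A k
  lookup-shift A k≢i k≢j =
    trans (lookup∘update′ k≢i (A [ j ]≔ outside) inside) (lookup∘update′ k≢j A outside)

  data View (A : Subset n) : Set where
    moves : lookup A j ≡ true → lookup A i ≡ false → δ i j A ≡ shift A → View A
    fixes : δ i j A ≡ A → lookup A j ≡ false ⊎ lookup A i ≡ true → View A

  view : ∀ A → View A
  view A = go (lookup A j) (lookup A i) refl refl
    where
    δ-by : Bool → Bool → Subset n
    δ-by a∋j a∋i = if a∋j ∧ not a∋i then shift A else A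
    go : ∀ a∋j a∋i → lookup A j ≡ a∋j → lookup A i ≡ a∋i → View A
    go true  false j∈A i∉A = moves j∈A i∉A (cong₂ δ-by j∈A i∉A)
    go true  true  j∈A i∈A = fixes (cong₂ δ-by j∈A i∈A) (inj₂ i∈A)
    go false _     j∉A i?A = fixes (cong₂ δ-by j∉A i?A) (inj₁ j∉A)

  ∈δ⁺ : ∀ A {k} → lookup A k ≡ true → k ≢ j → lookup (δ i j A) k ≡ true
  ∈δ⁺ A {k} k∈A k≢j with view A
  ... | fixes δA≡A _ = trans (cong-lookup δA≡A k) k∈A
  ... | moves _ _ δA≡shift with k ≟ᶠ i
  ...   | yes refl = trans (cong-lookup δA≡shift k) (i∈shift A)
  ...   | no k≢i   = trans (cong-lookup δA≡shift k) (trans (lookup-shift A k≢i k≢j) k∈A)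

  i∈δ : ∀ A → lookup A j ≡ true ⊎ lookup A i ≡ true → lookup (δ i j A) i ≡ true
  i∈δ A j∈A⊎i∈A with view A | j∈A⊎i∈A
  ... | moves _ _ δA≡shift   | _         = trans (cong-lookup δA≡shift i) (i∈shift A)
  ... | fixes δA≡A _          | inj₂ i∈A = trans (cong-lookup δA≡A i) i∈A
  ... | fixes δA≡A (inj₂ i∈A) | inj₁ _   = trans (cong-lookup δA≡A i) i∈A
  ... | fixes _ (inj₁ j∉A)    | inj₁ j∈A with () ← trans (sym j∈A) j∉A

  ∈δ⁻ : ∀ A {k} → lookup (δ i j A) k ≡ true → k ≡ i ⊎ lookup A k ≡ true
  ∈δ⁻ A {k} k∈δA with view A
  ... | fixes δA≡A _ = inj₂ (trans (sym (cong-lookup δA≡A k)) k∈δA)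
  ... | moves _ _ δA≡shift with k ≟ᶠ i | k ≟ᶠ j
  ...   | yes k≡i | _        = inj₁ k≡i
  ...   | no _    | yes refl with () ← trans (sym k∈δA) (trans (cong-lookup δA≡shift j) (j∉shift A))
  ...   | no k≢i  | no k≢j   =
    inj₂ (trans (sym (lookup-shift A k≢i k≢j)) (trans (sym (cong-lookup δA≡shift k)) k∈δA))

  j∈δ⇒i∈ : ∀ A → lookup (δ i j A) j ≡ true → lookup A i ≡ true
  j∈δ⇒i∈ A j∈δA with view A
  ... | moves _ _ δA≡shift with () ← trans (sym j∈δA) (trans (cong-lookup δA≡shift j) (j∉shift A))
  ... | fixes _ (inj₂ i∈A) = i∈A
  ... | fixes δA≡A (inj₁ j∉A) with () ← trans (sym j∈δA) (trans (cong-lookup δA≡A j) j∉A)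

  δ-idem : ∀ A → δ i j (δ i j A) ≡ δ i j A
  δ-idem A with view (δ i j A)
  ... | fixes δδA≡δA _ = δδA≡δA
  ... | moves j∈δA i∉δA _ with () ← trans (sym (i∈δ A (inj₂ (j∈δ⇒i∈ A j∈δA)))) i∉δA

  δ-moved⇒i∉ : ∀ A → δ i j A ≢ A → lookup A i ≡ false
  δ-moved⇒i∉ A δA≢A with view A
  ... | moves _ i∉A _ = i∉A
  ... | fixes δA≡A _  = ⊥-elim (δA≢A δA≡A)

  -- A moved set is recovered from its image: it contains j, misses i, and agrees with it elsewhere.
  δ-injective-moved : ∀ {A A'} → δ i j A ≢ A → δ i j A' ≢ A' → δ i j A ≡ δ i j A' → A ≡ A'
  δ-injective-moved {A} {A'} δA≢A δA'≢A' δA≡δA' with view A | view A'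
  ... | fixes δA≡A _ | _              = ⊥-elim (δA≢A δA≡A)
  ... | _            | fixes δA'≡A' _ = ⊥-elim (δA'≢A' δA'≡A')
  ... | moves j∈A i∉A δA≡shift | moves j∈A' i∉A' δA'≡shift = begin
    A                     ≡⟨ tabulate∘lookup A ⟨
    tabulate (lookup A)   ≡⟨ tabulate-cong agree ⟩
    tabulate (lookup A')  ≡⟨ tabulate∘lookup A' ⟩
    A'                    ∎
    where
    open ≡-Reasoning
    shifts-equal : shift A ≡ shift A'
    shifts-equal = trans (sym δA≡shift) (trans δA≡δA' δA'≡shift)
    agree : ∀ k → lookup A k ≡ lookup A' k
    agree k with k ≟ᶠ i | k ≟ᶠ j
    ... | yes refl | _        = trans i∉A (sym i∉A')
    ... | no _     | yes refl = trans j∈A (sym j∈A')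
    ... | no k≢i   | no k≢j   =
      trans (sym (lookup-shift A k≢i k≢j)) (trans (cong-lookup shifts-equal k) (lookup-shift A' k≢i k≢j))

  Meets-δ : ∀ {A C} → Meets A C → Meets (δ i j A) (δ i j C)
  Meets-δ {A} {C} (common k k∈A k∈C) with k ≟ᶠ j
  ... | yes refl = common i (i∈δ A (inj₁ k∈A)) (i∈δ C (inj₁ k∈C))
  ... | no k≢j   = common k (∈δ⁺ A k∈A k≢j) (∈δ⁺ C k∈C k≢j)

  Meets-δˡ : ∀ {A C} → Meets A C → (lookup C i ≡ false → Meets A (δ i j C)) → Meets (δ i j A) C
  Meets-δˡ {A} {C} (common k k∈A k∈C) viaδC with view A
  ... | fixes δA≡A _ = common k (trans (cong-lookup δA≡A k) k∈A) k∈C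
  ... | moves j∈A i∉A _ with k ≟ᶠ j
  ...   | no k≢j   = common k (∈δ⁺ A k∈A k≢j) k∈C
  ...   | yes refl with lookup C i Bool.≟ true
  ...     | yes i∈C = common i (i∈δ A (inj₁ j∈A)) i∈C
  ...     | no i∉C with viaδC (¬-not i∉C)
  ...       | common k' k'∈A k'∈δC with ∈δ⁻ C k'∈δC | k' ≟ᶠ j
  ...         | inj₁ refl | _        with () ← trans (sym k'∈A) i∉A
  ...         | inj₂ _    | yes refl = ⊥-elim (i∉C (j∈δ⇒i∈ C k'∈δC))
  ...         | inj₂ k'∈C | no k'≢j  = common k' (∈δ⁺ A k'∈A k'≢j) k'∈C

  Meets-δ-swap : ∀ {A A'} → lookup A i ≡ false → lookup A' i ≡ false →
    Meets (δ i j A) A' → Meets A (δ i j A')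
  Meets-δ-swap {A} {A'} i∉A i∉A' (common k k∈δA k∈A') with ∈δ⁻ A k∈δA | k ≟ᶠ j
  ... | inj₁ refl | _        with () ← trans (sym k∈A') i∉A'
  ... | inj₂ _    | yes refl with () ← trans (sym (j∈δ⇒i∈ A k∈δA)) i∉A
  ... | inj₂ k∈A  | no k≢j   = common k k∈A (∈δ⁺ A' k∈A' k≢j)

module Compression {n} {i j : Fin n} (i≢j : i ≢ j) (𝒜 : Family n) where

  open Shift i≢j
  open Δ-membership i j 𝒜

  ℬ : Family n
  ℬ = Δ i j 𝒜

  δ∈ℬ : ∀ {A} → A ∈F 𝒜 → δ i j A ∈F ℬ
  δ∈ℬ {A} A∈𝒜 with 𝒜 (δ i j A) Bool.≟ true
  ... | yes δA∈𝒜 = ∈Δ⁺-kept δA∈𝒜 (trans (cong 𝒜 (δ-idem A)) δA∈𝒜)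
  ... | no δA∉𝒜  = ∈Δ⁺-moved A∈𝒜 (¬-not δA∉𝒜)

  ℬ-δ-closed : ∀ {B} → B ∈F ℬ → δ i j B ∈F ℬ
  ℬ-δ-closed B∈ℬ with ∈Δ⁻ B∈ℬ
  ... | inj₁ (A , A∈𝒜 , δA∉𝒜 , refl) rewrite δ-idem A = ∈Δ⁺-moved A∈𝒜 δA∉𝒜
  ... | inj₂ (B∈𝒜 , _)                                = δ∈ℬ B∈𝒜

  δ-∈* : ∀ {A} → A ∈F (𝒜 *) → δ i j A ∈F (ℬ *)
  δ-∈* {A} A∈𝒜* = ∈*⁺ ℬ (δ∈ℬ A∈𝒜) meets-ℬ
    where
    A∈𝒜 : A ∈F 𝒜
    A∈𝒜 = proj₁ (∈*⁻ 𝒜 A∈𝒜*)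
    meets-𝒜 : ∀ {C} → C ∈F 𝒜 → Meets A C
    meets-𝒜 = proj₂ (∈*⁻ 𝒜 A∈𝒜*)
    meets-ℬ : ∀ {C} → C ∈F ℬ → Meets (δ i j A) C
    meets-ℬ C∈ℬ with ∈Δ⁻ C∈ℬ
    ... | inj₁ (A' , A'∈𝒜 , _ , refl) = Meets-δ (meets-𝒜 A'∈𝒜)
    ... | inj₂ (C∈𝒜 , δC∈𝒜)           = Meets-δˡ (meets-𝒜 C∈𝒜) (λ _ → meets-𝒜 δC∈𝒜)

  ∉ℬ*⇒moved : ∀ {A} → A ∈F (𝒜 *) → ¬ A ∈F (ℬ *) → δ i j A ≢ A
  ∉ℬ*⇒moved A∈𝒜* A∉ℬ* δA≡A = A∉ℬ* (subst (_∈F (ℬ *)) δA≡A (δ-∈* A∈𝒜*))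

  ∉ℬ*⇒δ∉𝒜* : ∀ {A} → A ∈F (𝒜 *) → ¬ A ∈F (ℬ *) → ¬ δ i j A ∈F (𝒜 *)
  ∉ℬ*⇒δ∉𝒜* {A} A∈𝒜* A∉ℬ* δA∈𝒜* = A∉ℬ* (∈*⁺ ℬ (∈Δ⁺-kept A∈𝒜 δA∈𝒜) meets-ℬ)
    where
    A∈𝒜 : A ∈F 𝒜
    A∈𝒜 = proj₁ (∈*⁻ 𝒜 A∈𝒜*)
    δA∈𝒜 : δ i j A ∈F 𝒜
    δA∈𝒜 = proj₁ (∈*⁻ 𝒜 δA∈𝒜*)
    i∉A : lookup A i ≡ false
    i∉A = δ-moved⇒i∉ A (∉ℬ*⇒moved A∈𝒜* A∉ℬ*)
    meets-ℬ : ∀ {C} → C ∈F ℬ → Meets A C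
    meets-ℬ C∈ℬ with ∈Δ⁻ C∈ℬ
    ... | inj₂ (C∈𝒜 , _) = proj₂ (∈*⁻ 𝒜 A∈𝒜*) C∈𝒜
    ... | inj₁ (A' , A'∈𝒜 , δA'∉𝒜 , refl) =
      Meets-δ-swap i∉A (δ-moved⇒i∉ A' δA'≢A') (proj₂ (∈*⁻ 𝒜 δA∈𝒜*) A'∈𝒜)
      where
      δA'≢A' : δ i j A' ≢ A'
      δA'≢A' δA'≡A' with () ← trans (sym δA'∉𝒜) (trans (cong 𝒜 δA'≡A') A'∈𝒜)

  δ-∈ℬ* : ∀ {B} → B ∈F (ℬ *) → δ i j B ∈F (ℬ *)
  δ-∈ℬ* {B} B∈ℬ* = ∈*⁺ ℬ (ℬ-δ-closed B∈ℬ) λ C∈ℬ →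
    Meets-δˡ (meets-ℬ C∈ℬ) (λ _ → meets-ℬ (ℬ-δ-closed C∈ℬ))
    where
    B∈ℬ : B ∈F ℬ
    B∈ℬ = proj₁ (∈*⁻ ℬ B∈ℬ*)
    meets-ℬ : ∀ {C} → C ∈F ℬ → Meets B C
    meets-ℬ = proj₂ (∈*⁻ ℬ B∈ℬ*)

  card-*≤card-ℬ* : card (𝒜 *) ≤ card (ℬ *)
  card-*≤card-ℬ* = card-≤-injection (𝒜 *) (ℬ *) f f-maps f-injective
    where
    f : Subset n → Subset n
    f A = if (ℬ *) A then A else δ i j A
    f-maps : ∀ {A} → A ∈F (𝒜 *) → f A ∈F (ℬ *)
    f-maps {A} A∈𝒜* with (ℬ *) A in A?ℬ*
    ... | true  = A?ℬ*
    ... | false = δ-∈* A∈𝒜*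
    f-injective : ∀ {A C} → A ∈F (𝒜 *) → C ∈F (𝒜 *) → f A ≡ f C → A ≡ C
    f-injective {A} {C} A∈𝒜* C∈𝒜* fA≡fC with (ℬ *) A in A?ℬ* | (ℬ *) C in C?ℬ*
    ... | true  | true  = fA≡fC
    ... | true  | false = ⊥-elim (∉ℬ*⇒δ∉𝒜* C∈𝒜* (not-¬ C?ℬ*) (subst (_∈F (𝒜 *)) fA≡fC A∈𝒜*))
    ... | false | true  = ⊥-elim (∉ℬ*⇒δ∉𝒜* A∈𝒜* (not-¬ A?ℬ*) (subst (_∈F (𝒜 *)) (sym fA≡fC) C∈𝒜*))
    ... | false | false =
      δ-injective-moved (∉ℬ*⇒moved A∈𝒜* (not-¬ A?ℬ*)) (∉ℬ*⇒moved C∈𝒜* (not-¬ C?ℬ*)) fA≡fC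

lemma4p1 : (n : ℕ) (𝒜 : Family n) (i j : Fin n) → i ≢ j →
    ((A : Subset n) → A ∈F (𝒜 *) → δ i j A ∈F (Δ i j 𝒜 *))
    × ((A : Subset n) → A ∈F (𝒜 *) → ¬ (A ∈F (Δ i j 𝒜 *)) → ¬ (δ i j A ∈F (𝒜 *)))
    × ((B : Subset n) → B ∈F (Δ i j 𝒜 *) → δ i j B ∈F (Δ i j 𝒜 *))
    × (card (𝒜 *) ≤ card (Δ i j 𝒜 *))
lemma4p1 n 𝒜 i j i≢j =
  (λ _ → δ-∈*) , (λ _ → ∉ℬ*⇒δ∉𝒜*) , (λ _ → δ-∈ℬ*) , card-*≤card-ℬ*
  where open Compression i≢j 𝒜
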